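{- For every integer $n\ge 0$, $$\sum_{k=0}^n\frac{k^3\binom{n}{k}\binom{n+k}{k}\binom{2k}{k}}{(-4)^k}=\frac{\binom{2\lfloor n/2\rfloor}{\lfloor n/2\rfloor}^2}{16^{\lfloor n/2\rfloor}}\cdot\begin{cases} \dfrac{n^2(n+1)^2(2n+1)^2}{15} & \text{if $n$ is even},\\[2mm] -\dfrac{n^2(4n^4+8n^3+3n^2-n+1)}{15} & \text{if $n$ is odd}.\end{cases}$$ -}

module Defs where

open import Data.Nat as ℕ using (ℕ; zero; suc; _/_; _%_)
open import Data.Nat.Combinatorics using (_C_)
open import Data.Integer as ℤ using (ℤ; +_)
open import Data.Rational as ℚ using (ℚ)
open import Data.Nat.Properties using (m^n≢0; m*n≢0)
open import Data.List using (List; map; upTo; foldr)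

sumℚ : List ℚ → ℚ
sumℚ = foldr ℚ._+_ ℚ.0ℚ

Σ≤ : ℕ → (ℕ → ℚ) → ℚ
Σ≤ n f = sumℚ (map f (upTo (suc n)))

-- k^3 C(n,k) C(n+k,k) C(2k,k) / (-4)^k   (sign (-1)^k put in numerator)
term : ℕ → ℕ → ℚ
term n k = ((ℤ.- ℤ.1ℤ) ℤ.^ k ℤ.* (+ (k ℕ.^ 3 ℕ.* (n C k) ℕ.* ((n ℕ.+ k) C k) ℕ.* ((2 ℕ.* k) C k))))
           ℚ./ (4 ℕ.^ k) where instance _ = m^n≢0 4 k

lhs : ℕ → ℚ
lhs n = Σ≤ n (term n)

poly15 : ℕ → ℤ
poly15 n with n % 2
... | 0 = + (n ℕ.^ 2 ℕ.* (n ℕ.+ 1) ℕ.^ 2 ℕ.* (2 ℕ.* n ℕ.+ 1) ℕ.^ 2)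
... | _ = ℤ.- (+ (n ℕ.^ 2) ℤ.* (+ 4 ℤ.* (+ n) ℤ.^ 4 ℤ.+ + 8 ℤ.* (+ n) ℤ.^ 3 ℤ.+ + 3 ℤ.* (+ n) ℤ.^ 2 ℤ.- (+ n) ℤ.+ + 1))

rhs : ℕ → ℚ
rhs n = (+ (((2 ℕ.* m) C m) ℕ.^ 2) ℤ.* poly15 n) ℚ./ (16 ℕ.^ m ℕ.* 15)
  where
  m = n / 2
  instance
    _ = m^n≢0 16 m
    _ = m*n≢0 (16 ℕ.^ m) 15

{-# OPTIONS --safe #-}
-- Both sides satisfy the recurrence
--   (n+1)⁴ u(n+2) + (2n+3)(3n²+9n+5) u(n+1) = (n+2)⁴ u(n),
-- whose leading coefficient never vanishes, and agree at n = 0 and n = 1 (values 0 and −1).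
-- For the sum this is creative telescoping: the summand F(n,k) satisfies
--   (n+1)⁴ F(n+2,k) + (2n+3)(3n²+9n+5) F(n+1,k) − (n+2)⁴ F(n,k) = G(n,k+1) − G(n,k)
-- with G(n,k) = −(−1)ᵏ 2(2n+3) k³ (k−1)³ C(2k,k) C(n+k,k) C(n+2,k) / 4ᵏ, which vanishes
-- at k = 0 and for k > n+2.  For the closed form, (m+1) C(2m+2,m+1) = 2(2m+1) C(2m,m)
-- turns the recurrence at n = 2m and at n = 2m+1 into polynomial identities in m.
module Submission where

open import Defs
open import Data.Nat using (ℕ)
open import Relation.Binary.PropositionalEquality using (_≡_)

open import Data.Nat as ℕ using (zero; suc)
import Data.Nat.Properties as ℕ
open import Data.Nat.DivMod using (m*n/n≡m; m*n%n≡0; /-congˡ; %-congˡ; +-distrib-/-∣ʳ; %-remove-+ʳ)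
open import Data.Nat.Divisibility using (m∣m*n)
open import Data.Nat.Combinatorics using (_C_; nC1≡n; nCk+nC[k+1]≡[n+1]C[k+1]; k>n⇒nCk≡0)
open import Data.Integer as ℤ using (ℤ; +_; 0ℤ; 1ℤ)
import Data.Integer.Properties as ℤ
open import Data.Nat.Tactic.RingSolver using () renaming (solve-∀ to ℕ-solve-∀)
open import Data.Integer.Tactic.RingSolver using (solve-∀; solve)
open import Data.Rational as ℚ using (ℚ; _/_; 0ℚ; 1ℚ; toℚᵘ)
import Data.Rational.Properties as ℚ
open import Data.Rational.Unnormalised as ℚᵘ using (mkℚᵘ; *≡*)
import Data.Rational.Unnormalised.Properties as ℚᵘ
open import Data.Rational.Solver using (module +-*-Solver)
open +-*-Solver using (con; _:+_; _:-_; _:*_; _:=_) renaming (solve to ℚ-solve)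
open import Data.List using (_∷_; []; applyUpTo; map)
open import Data.Product using (_×_; _,_; proj₁; proj₂)
open import Function using (id; _∘_; case_of_)
open import Relation.Binary.PropositionalEquality

[k+1]*[n+1]C[k+1]≡[n+1]*nCk : ∀ n k → suc k ℕ.* (suc n C suc k) ≡ suc n ℕ.* (n C k)
[k+1]*[n+1]C[k+1]≡[n+1]*nCk zero    zero    = refl
[k+1]*[n+1]C[k+1]≡[n+1]*nCk zero    (suc k) = ℕ.*-zeroʳ (suc (suc k))
[k+1]*[n+1]C[k+1]≡[n+1]*nCk (suc n) zero    =
  trans (ℕ.+-identityʳ _) (trans (nC1≡n (suc (suc n))) (sym (ℕ.*-identityʳ (suc (suc n)))))
[k+1]*[n+1]C[k+1]≡[n+1]*nCk (suc n) (suc k) = begin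
  suc (suc k) ℕ.* (suc (suc n) C suc (suc k))
    ≡⟨ cong (suc (suc k) ℕ.*_) (sym (nCk+nC[k+1]≡[n+1]C[k+1] (suc n) (suc k))) ⟩
  suc (suc k) ℕ.* (X ℕ.+ Y)
    ≡⟨ split (suc k) X Y ⟩
  suc k ℕ.* X ℕ.+ suc (suc k) ℕ.* Y ℕ.+ X
    ≡⟨ cong₂ (λ u v → u ℕ.+ v ℕ.+ X) ([k+1]*[n+1]C[k+1]≡[n+1]*nCk n k) ([k+1]*[n+1]C[k+1]≡[n+1]*nCk n (suc k)) ⟩
  suc n ℕ.* (n C k) ℕ.+ suc n ℕ.* (n C suc k) ℕ.+ X
    ≡⟨ cong (λ u → u ℕ.+ X) (sym (ℕ.*-distribˡ-+ (suc n) (n C k) (n C suc k))) ⟩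
  suc n ℕ.* (n C k ℕ.+ n C suc k) ℕ.+ X
    ≡⟨ cong (λ u → suc n ℕ.* u ℕ.+ X) (nCk+nC[k+1]≡[n+1]C[k+1] n k) ⟩
  suc n ℕ.* X ℕ.+ X
    ≡⟨ ℕ.+-comm (suc n ℕ.* X) X ⟩
  suc (suc n) ℕ.* X
    ∎
  where
  open ≡-Reasoning
  X Y : ℕ
  X = suc n C suc k
  Y = suc n C suc (suc k)
  split : ∀ k x y → suc k ℕ.* (x ℕ.+ y) ≡ k ℕ.* x ℕ.+ suc k ℕ.* y ℕ.+ x
  split = ℕ-solve-∀

[n+1]*nCk+k*[n+1]Ck≡[n+1]*[n+1]Ck : ∀ n k → suc n ℕ.* (n C k) ℕ.+ k ℕ.* (suc n C k) ≡ suc n ℕ.* (suc n C k)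
[n+1]*nCk+k*[n+1]Ck≡[n+1]*[n+1]Ck n zero    = ℕ.+-identityʳ _
[n+1]*nCk+k*[n+1]Ck≡[n+1]*[n+1]Ck n (suc k) = begin
  suc n ℕ.* (n C suc k) ℕ.+ suc k ℕ.* (suc n C suc k)
    ≡⟨ cong (suc n ℕ.* (n C suc k) ℕ.+_) ([k+1]*[n+1]C[k+1]≡[n+1]*nCk n k) ⟩
  suc n ℕ.* (n C suc k) ℕ.+ suc n ℕ.* (n C k)
    ≡⟨ sym (ℕ.*-distribˡ-+ (suc n) (n C suc k) (n C k)) ⟩
  suc n ℕ.* (n C suc k ℕ.+ n C k)
    ≡⟨ cong (suc n ℕ.*_) (trans (ℕ.+-comm (n C suc k) (n C k)) (nCk+nC[k+1]≡[n+1]C[k+1] n k)) ⟩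
  suc n ℕ.* (suc n C suc k)
    ∎
  where open ≡-Reasoning

C-absorption : ∀ n k → + suc k ℤ.* + (suc n C suc k) ≡ + suc n ℤ.* + (n C k)
C-absorption n k = trans (sym (ℤ.pos-* (suc k) _)) (trans (cong +_ ([k+1]*[n+1]C[k+1]≡[n+1]*nCk n k)) (ℤ.pos-* (suc n) _))

C-row-ratio : ∀ n k → + suc n ℤ.* + (n C k) ≡ (+ suc n ℤ.- + k) ℤ.* + (suc n C k)
C-row-ratio n k = isolate (+ suc n) (+ (n C k)) (+ k) (+ (suc n C k)) (begin
  + suc n ℤ.* + (n C k) ℤ.+ + k ℤ.* + (suc n C k)   ≡⟨ sym (cong₂ ℤ._+_ (ℤ.pos-* (suc n) _) (ℤ.pos-* k _)) ⟩
  + (suc n ℕ.* (n C k) ℕ.+ k ℕ.* (suc n C k))       ≡⟨ cong +_ ([n+1]*nCk+k*[n+1]Ck≡[n+1]*[n+1]Ck n k) ⟩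
  + (suc n ℕ.* (suc n C k))                         ≡⟨ ℤ.pos-* (suc n) _ ⟩
  + suc n ℤ.* + (suc n C k)                         ∎)
  where
  open ≡-Reasoning
  isolate : ∀ a x k y → a ℤ.* x ℤ.+ k ℤ.* y ≡ a ℤ.* y → a ℤ.* x ≡ (a ℤ.- k) ℤ.* y
  isolate a x k y eq = begin
    a ℤ.* x                               ≡⟨ solve (a ∷ x ∷ k ∷ y ∷ []) ⟩
    (a ℤ.* x ℤ.+ k ℤ.* y) ℤ.- k ℤ.* y     ≡⟨ cong (ℤ._- k ℤ.* y) eq ⟩
    a ℤ.* y ℤ.- k ℤ.* y                   ≡⟨ solve (a ∷ k ∷ y ∷ []) ⟩
    (a ℤ.- k) ℤ.* y                       ∎

C-central-ratio : ∀ k → + suc k ℤ.* + ((2 ℕ.* suc k) C suc k) ≡ + 2 ℤ.* (1ℤ ℤ.+ + 2 ℤ.* + k) ℤ.* + ((2 ℕ.* k) C k)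
C-central-ratio k = ℤ.*-cancelˡ-≡ (+ suc k) _ _ (times-[k+1] (+ k) (+ ((2 ℕ.* k) C k)) (+ (suc (2 ℕ.* k) C k)) (+ ((2 ℕ.* suc k) C suc k)) row absorb)
  where
  2k≡2*k : + (2 ℕ.* k) ≡ + 2 ℤ.* + k
  2k≡2*k = ℤ.pos-* 2 k
  row : (1ℤ ℤ.+ + 2 ℤ.* + k) ℤ.* + ((2 ℕ.* k) C k) ≡ (1ℤ ℤ.+ + 2 ℤ.* + k ℤ.- + k) ℤ.* + (suc (2 ℕ.* k) C k)
  row = subst (λ T → (1ℤ ℤ.+ T) ℤ.* + ((2 ℕ.* k) C k) ≡ (1ℤ ℤ.+ T ℤ.- + k) ℤ.* + (suc (2 ℕ.* k) C k))
              2k≡2*k (C-row-ratio (2 ℕ.* k) k)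
  absorb : (1ℤ ℤ.+ + k) ℤ.* + ((2 ℕ.* suc k) C suc k) ≡ (+ 2 ℤ.+ + 2 ℤ.* + k) ℤ.* + (suc (2 ℕ.* k) C k)
  absorb = subst₂ (λ m T → + suc k ℤ.* + (m C suc k) ≡ (+ 2 ℤ.+ T) ℤ.* + (suc (2 ℕ.* k) C k))
                  (sym (ℕ.*-suc 2 k)) 2k≡2*k (C-absorption (suc (2 ℕ.* k)) k)
  times-[k+1] : ∀ K A Z A′ → (1ℤ ℤ.+ + 2 ℤ.* K) ℤ.* A ≡ (1ℤ ℤ.+ + 2 ℤ.* K ℤ.- K) ℤ.* Z →
            (1ℤ ℤ.+ K) ℤ.* A′ ≡ (+ 2 ℤ.+ + 2 ℤ.* K) ℤ.* Z →
            (1ℤ ℤ.+ K) ℤ.* ((1ℤ ℤ.+ K) ℤ.* A′) ≡ (1ℤ ℤ.+ K) ℤ.* (+ 2 ℤ.* (1ℤ ℤ.+ + 2 ℤ.* K) ℤ.* A)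
  times-[k+1] K A Z A′ row absorb = begin
    (1ℤ ℤ.+ K) ℤ.* ((1ℤ ℤ.+ K) ℤ.* A′)               ≡⟨ cong ((1ℤ ℤ.+ K) ℤ.*_) absorb ⟩
    (1ℤ ℤ.+ K) ℤ.* ((+ 2 ℤ.+ + 2 ℤ.* K) ℤ.* Z)       ≡⟨ solve (K ∷ Z ∷ []) ⟩
    + 2 ℤ.* (1ℤ ℤ.+ K) ℤ.* ((1ℤ ℤ.+ + 2 ℤ.* K ℤ.- K) ℤ.* Z) ≡⟨ cong (+ 2 ℤ.* (1ℤ ℤ.+ K) ℤ.*_) (sym row) ⟩
    + 2 ℤ.* (1ℤ ℤ.+ K) ℤ.* ((1ℤ ℤ.+ + 2 ℤ.* K) ℤ.* A) ≡⟨ solve (K ∷ A ∷ []) ⟩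
    (1ℤ ℤ.+ K) ℤ.* (+ 2 ℤ.* (1ℤ ℤ.+ + 2 ℤ.* K) ℤ.* A) ∎
    where open ≡-Reasoning

fromℤ : ℤ → ℚ
fromℤ i = i / 1

toℚᵘ-/ : ∀ i d .{{_ : ℕ.NonZero d}} → toℚᵘ (i / d) ℚᵘ.≃ mkℚᵘ i (ℕ.pred d)
toℚᵘ-/ i (suc d) = ℚ.toℚᵘ-fromℚᵘ (mkℚᵘ i d)

cross⇒/≡ : ∀ i j d e .{{_ : ℕ.NonZero d}} .{{_ : ℕ.NonZero e}} →
           i ℤ.* + e ≡ j ℤ.* + d → i / d ≡ j / e
cross⇒/≡ i j d@(suc _) e@(suc _) eq =
  ℚ.toℚᵘ-injective (ℚᵘ.≃-trans (toℚᵘ-/ i d) (ℚᵘ.≃-trans (*≡* eq) (ℚᵘ.≃-sym (toℚᵘ-/ j e))))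

/≡⇒cross : ∀ i j d e .{{_ : ℕ.NonZero d}} .{{_ : ℕ.NonZero e}} →
           i / d ≡ j / e → i ℤ.* + e ≡ j ℤ.* + d
/≡⇒cross i j d@(suc _) e@(suc _) eq
  with ℚᵘ.≃-trans (ℚᵘ.≃-sym (toℚᵘ-/ i d)) (ℚᵘ.≃-trans (ℚ.toℚᵘ-cong eq) (toℚᵘ-/ j e))
... | *≡* cross = cross

/-+-/ : ∀ i j d e .{{_ : ℕ.NonZero d}} .{{_ : ℕ.NonZero e}} →
        i / d ℚ.+ j / e ≡ ((i ℤ.* + e ℤ.+ j ℤ.* + d) / (d ℕ.* e)) {{ℕ.m*n≢0 d e}}
/-+-/ i j d@(suc _) e@(suc _) = ℚ.toℚᵘ-injective (ℚᵘ.≃-trans (ℚ.toℚᵘ-homo-+ (i / d) (j / e))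
  (ℚᵘ.≃-trans (ℚᵘ.+-cong (toℚᵘ-/ i d) (toℚᵘ-/ j e)) (ℚᵘ.≃-sym (toℚᵘ-/ (i ℤ.* + e ℤ.+ j ℤ.* + d) (d ℕ.* e)))))

/-*-/ : ∀ i j d e .{{_ : ℕ.NonZero d}} .{{_ : ℕ.NonZero e}} →
        (i / d) ℚ.* (j / e) ≡ ((i ℤ.* j) / (d ℕ.* e)) {{ℕ.m*n≢0 d e}}
/-*-/ i j d@(suc _) e@(suc _) = ℚ.toℚᵘ-injective (ℚᵘ.≃-trans (ℚ.toℚᵘ-homo-* (i / d) (j / e))
  (ℚᵘ.≃-trans (ℚᵘ.*-cong (toℚᵘ-/ i d) (toℚᵘ-/ j e)) (ℚᵘ.≃-sym (toℚᵘ-/ (i ℤ.* j) (d ℕ.* e)))))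

-‿/ : ∀ i d .{{_ : ℕ.NonZero d}} → ℚ.- (i / d) ≡ (ℤ.- i) / d
-‿/ i d@(suc _) = ℚ.toℚᵘ-injective (ℚᵘ.≃-trans (ℚ.toℚᵘ-homo‿- (i / d))
  (ℚᵘ.≃-trans (ℚᵘ.-‿cong (toℚᵘ-/ i d)) (ℚᵘ.≃-sym (toℚᵘ-/ (ℤ.- i) d))))

+-/-common : ∀ i j d .{{_ : ℕ.NonZero d}} → i / d ℚ.+ j / d ≡ (i ℤ.+ j) / d
+-/-common i j d = trans (/-+-/ i j d d) (cross⇒/≡ (i ℤ.* + d ℤ.+ j ℤ.* + d) (i ℤ.+ j) (d ℕ.* d) d {{ℕ.m*n≢0 d d}}
  (trans (distrib i j (+ d)) (cong ((i ℤ.+ j) ℤ.*_) (sym (ℤ.pos-* d d)))))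
  where
  distrib : ∀ i j d → (i ℤ.* d ℤ.+ j ℤ.* d) ℤ.* d ≡ (i ℤ.+ j) ℤ.* (d ℤ.* d)
  distrib = solve-∀

-‿/-common : ∀ i j d .{{_ : ℕ.NonZero d}} → i / d ℚ.- j / d ≡ (i ℤ.- j) / d
-‿/-common i j d = trans (cong (i / d ℚ.+_) (-‿/ j d)) (+-/-common i (ℤ.- j) d)

fromℤ-*-/ : ∀ a i d .{{_ : ℕ.NonZero d}} → fromℤ a ℚ.* (i / d) ≡ (a ℤ.* i) / d
fromℤ-*-/ a i d = trans (/-*-/ a i 1 d) (ℚ./-cong {a ℤ.* i} {1 ℕ.* d} {{ℕ.m*n≢0 1 d}} refl (ℕ.*-identityˡ d))

/-scale : ∀ c i d .{{_ : ℕ.NonZero c}} .{{_ : ℕ.NonZero d}} →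
          i / d ≡ ((+ c ℤ.* i) / (c ℕ.* d)) {{ℕ.m*n≢0 c d}}
/-scale c i d = cross⇒/≡ i (+ c ℤ.* i) d (c ℕ.* d) {{_}} {{ℕ.m*n≢0 c d}}
  (trans (cong (i ℤ.*_) (ℤ.pos-* c d)) (swap i (+ c) (+ d)))
  where
  swap : ∀ i c d → i ℤ.* (c ℤ.* d) ≡ c ℤ.* i ℤ.* d
  swap = solve-∀

i≡0⇒i/n≡0 : ∀ {i} d .{{_ : ℕ.NonZero d}} → i ≡ 0ℤ → i / d ≡ 0ℚ
i≡0⇒i/n≡0 d refl = ℚ.0/n≡0 d

fromℤ-nonZero : ∀ i → .{{ℤ.NonZero i}} → ℚ.NonZero (fromℤ i)
fromℤ-nonZero i@(ℤ.+[1+ _ ]) = ℚ.≢-nonZero λ i/1≡0 → case /≡⇒cross i 0ℤ 1 1 i/1≡0 of λ ()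
fromℤ-nonZero i@(ℤ.-[1+ _ ]) = ℚ.≢-nonZero λ i/1≡0 → case /≡⇒cross i 0ℤ 1 1 i/1≡0 of λ ()

p-q≡0⇒p≡q : ∀ {p q} → p ℚ.- q ≡ 0ℚ → p ≡ q
p-q≡0⇒p≡q {p} {q} eq = trans (ℚ-solve 2 (λ p q → p := (p :- q) :+ q) refl p q) (trans (cong (ℚ._+ q) eq) (ℚ.+-identityˡ q))

fraction-combination : ∀ a₂ a₁ a₀ u₂ u₁ u₀ d .{{_ : ℕ.NonZero d}} →
  a₂ ℤ.* u₂ ℤ.+ a₁ ℤ.* u₁ ≡ a₀ ℤ.* u₀ →
  fromℤ a₂ ℚ.* (u₂ / d) ℚ.+ fromℤ a₁ ℚ.* (u₁ / d) ≡ fromℤ a₀ ℚ.* (u₀ / d)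
fraction-combination a₂ a₁ a₀ u₂ u₁ u₀ d eq = begin
  fromℤ a₂ ℚ.* (u₂ / d) ℚ.+ fromℤ a₁ ℚ.* (u₁ / d) ≡⟨ cong₂ ℚ._+_ (fromℤ-*-/ a₂ u₂ d) (fromℤ-*-/ a₁ u₁ d) ⟩
  (a₂ ℤ.* u₂) / d ℚ.+ (a₁ ℤ.* u₁) / d               ≡⟨ +-/-common (a₂ ℤ.* u₂) (a₁ ℤ.* u₁) d ⟩
  (a₂ ℤ.* u₂ ℤ.+ a₁ ℤ.* u₁) / d                       ≡⟨ cong (_/ d) eq ⟩
  (a₀ ℤ.* u₀) / d                                     ≡⟨ sym (fromℤ-*-/ a₀ u₀ d) ⟩
  fromℤ a₀ ℚ.* (u₀ / d)                               ∎
  where open ≡-Reasoning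

telescoping-fractions : ∀ a₂ a₁ a₀ u₂ u₁ u₀ g₁ g₀ d .{{_ : ℕ.NonZero d}} →
  + 4 ℤ.* (a₂ ℤ.* u₂ ℤ.+ a₁ ℤ.* u₁ ℤ.- a₀ ℤ.* u₀) ≡ g₁ ℤ.- + 4 ℤ.* g₀ →
  fromℤ a₂ ℚ.* (u₂ / d) ℚ.+ fromℤ a₁ ℚ.* (u₁ / d) ℚ.- fromℤ a₀ ℚ.* (u₀ / d)
  ≡ (g₁ / (4 ℕ.* d)) {{ℕ.m*n≢0 4 d}} ℚ.- g₀ / d
telescoping-fractions a₂ a₁ a₀ u₂ u₁ u₀ g₁ g₀ d eq = begin
  fromℤ a₂ ℚ.* (u₂ / d) ℚ.+ fromℤ a₁ ℚ.* (u₁ / d) ℚ.- fromℤ a₀ ℚ.* (u₀ / d)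
    ≡⟨ cong₂ ℚ._-_ (cong₂ ℚ._+_ (fromℤ-*-/ a₂ u₂ d) (fromℤ-*-/ a₁ u₁ d)) (fromℤ-*-/ a₀ u₀ d) ⟩
  (a₂ ℤ.* u₂) / d ℚ.+ (a₁ ℤ.* u₁) / d ℚ.- (a₀ ℤ.* u₀) / d
    ≡⟨ cong (ℚ._- (a₀ ℤ.* u₀) / d) (+-/-common (a₂ ℤ.* u₂) (a₁ ℤ.* u₁) d) ⟩
  (a₂ ℤ.* u₂ ℤ.+ a₁ ℤ.* u₁) / d ℚ.- (a₀ ℤ.* u₀) / d
    ≡⟨ -‿/-common (a₂ ℤ.* u₂ ℤ.+ a₁ ℤ.* u₁) (a₀ ℤ.* u₀) d ⟩
  (a₂ ℤ.* u₂ ℤ.+ a₁ ℤ.* u₁ ℤ.- a₀ ℤ.* u₀) / d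
    ≡⟨ /-scale 4 (a₂ ℤ.* u₂ ℤ.+ a₁ ℤ.* u₁ ℤ.- a₀ ℤ.* u₀) d ⟩
  (+ 4 ℤ.* (a₂ ℤ.* u₂ ℤ.+ a₁ ℤ.* u₁ ℤ.- a₀ ℤ.* u₀)) / (4 ℕ.* d)
    ≡⟨ cong (_/ (4 ℕ.* d)) eq ⟩
  (g₁ ℤ.- + 4 ℤ.* g₀) / (4 ℕ.* d)
    ≡⟨ sym (-‿/-common g₁ (+ 4 ℤ.* g₀) (4 ℕ.* d) {{ℕ.m*n≢0 4 d}}) ⟩
  g₁ / (4 ℕ.* d) ℚ.- (+ 4 ℤ.* g₀) / (4 ℕ.* d)
    ≡⟨ cong (λ q → g₁ / (4 ℕ.* d) ℚ.- q) (sym (/-scale 4 g₀ d)) ⟩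
  g₁ / (4 ℕ.* d) ℚ.- g₀ / d
    ∎
  where
  open ≡-Reasoning
  instance _ = ℕ.m*n≢0 4 d

Σ< : ℕ → (ℕ → ℚ) → ℚ
Σ< zero    f = 0ℚ
Σ< (suc N) f = f 0 ℚ.+ Σ< N (f ∘ suc)

sumℚ-map-applyUpTo : ∀ N (g : ℕ → ℕ) f → sumℚ (map f (applyUpTo g N)) ≡ Σ< N (f ∘ g)
sumℚ-map-applyUpTo zero    g f = refl
sumℚ-map-applyUpTo (suc N) g f = cong (f (g 0) ℚ.+_) (sumℚ-map-applyUpTo N (g ∘ suc) f)

Σ≤≡Σ< : ∀ n f → Σ≤ n f ≡ Σ< (suc n) f
Σ≤≡Σ< n = sumℚ-map-applyUpTo (suc n) id

Σ<-cong : ∀ N {f g : ℕ → ℚ} → (∀ k → f k ≡ g k) → Σ< N f ≡ Σ< N g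
Σ<-cong zero    f≡g = refl
Σ<-cong (suc N) f≡g = cong₂ ℚ._+_ (f≡g 0) (Σ<-cong N (f≡g ∘ suc))

Σ<-snoc : ∀ N f → Σ< (suc N) f ≡ Σ< N f ℚ.+ f N
Σ<-snoc zero    f = trans (ℚ.+-identityʳ (f 0)) (sym (ℚ.+-identityˡ (f 0)))
Σ<-snoc (suc N) f = trans (cong (f 0 ℚ.+_) (Σ<-snoc N (f ∘ suc))) (sym (ℚ.+-assoc (f 0) _ _))

Σ<-pad : ∀ N f → f N ≡ 0ℚ → Σ< N f ≡ Σ< (suc N) f
Σ<-pad N f fN≡0 = sym (trans (Σ<-snoc N f) (trans (cong (Σ< N f ℚ.+_) fN≡0) (ℚ.+-identityʳ (Σ< N f))))

Σ<-telescope : ∀ N (G : ℕ → ℚ) → Σ< N (λ k → G (suc k) ℚ.- G k) ≡ G N ℚ.- G 0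
Σ<-telescope zero    G = sym (ℚ.+-inverseʳ (G 0))
Σ<-telescope (suc N) G = trans (cong ((G 1 ℚ.- G 0) ℚ.+_) (Σ<-telescope N (G ∘ suc)))
  (ℚ-solve 3 (λ a b c → (b :- a) :+ (c :- b) := c :- a) refl (G 0) (G 1) (G (suc N)))

Σ<-linear : ∀ N a b c (f g h : ℕ → ℚ) →
            Σ< N (λ k → a ℚ.* f k ℚ.+ b ℚ.* g k ℚ.- c ℚ.* h k)
            ≡ a ℚ.* Σ< N f ℚ.+ b ℚ.* Σ< N g ℚ.- c ℚ.* Σ< N h
Σ<-linear zero    a b c f g h = ℚ-solve 3 (λ a b c → con 0ℚ := a :* con 0ℚ :+ b :* con 0ℚ :- c :* con 0ℚ) refl a b c
Σ<-linear (suc N) a b c f g h = trans (cong (a ℚ.* f 0 ℚ.+ b ℚ.* g 0 ℚ.- c ℚ.* h 0 ℚ.+_) (Σ<-linear N a b c (f ∘ suc) (g ∘ suc) (h ∘ suc)))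
  (ℚ-solve 9 (λ a b c x y z X Y Z → (a :* x :+ b :* y :- c :* z) :+ (a :* X :+ b :* Y :- c :* Z)
                                  := a :* (x :+ X) :+ b :* (y :+ Y) :- c :* (z :+ Z))
         refl a b c (f 0) (g 0) (h 0) (Σ< N (f ∘ suc)) (Σ< N (g ∘ suc)) (Σ< N (h ∘ suc)))

order2-recurrence-unique : (a b c : ℕ → ℚ) → (∀ n → ℚ.NonZero (a n)) → (f g : ℕ → ℚ) →
  (∀ n → a n ℚ.* f (suc (suc n)) ℚ.+ b n ℚ.* f (suc n) ≡ c n ℚ.* f n) →
  (∀ n → a n ℚ.* g (suc (suc n)) ℚ.+ b n ℚ.* g (suc n) ≡ c n ℚ.* g n) →
  f 0 ≡ g 0 → f 1 ≡ g 1 → ∀ n → f n ≡ g n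
order2-recurrence-unique a b c a≢0 f g rec-f rec-g f₀ f₁ n = proj₁ (agree n)
  where
  cancel : ∀ n {p q} → a n ℚ.* p ≡ a n ℚ.* q → p ≡ q
  cancel n {p} {q} eq = begin
    p                        ≡⟨ sym (ℚ.*-identityˡ p) ⟩
    1ℚ ℚ.* p                 ≡⟨ cong (ℚ._* p) (sym (ℚ.*-inverseˡ (a n) {{a≢0 n}})) ⟩
    (1/a ℚ.* a n) ℚ.* p      ≡⟨ ℚ.*-assoc 1/a (a n) p ⟩
    1/a ℚ.* (a n ℚ.* p)      ≡⟨ cong (1/a ℚ.*_) eq ⟩
    1/a ℚ.* (a n ℚ.* q)      ≡⟨ sym (ℚ.*-assoc 1/a (a n) q) ⟩
    (1/a ℚ.* a n) ℚ.* q      ≡⟨ cong (ℚ._* q) (ℚ.*-inverseˡ (a n) {{a≢0 n}}) ⟩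
    1ℚ ℚ.* q                 ≡⟨ ℚ.*-identityˡ q ⟩
    q                        ∎
    where
    open ≡-Reasoning
    1/a : ℚ
    1/a = ℚ.1/_ (a n) {{a≢0 n}}
  step : ∀ n → f n ≡ g n → f (suc n) ≡ g (suc n) → f (suc (suc n)) ≡ g (suc (suc n))
  step n e₀ e₁ = cancel n (begin
    a n ℚ.* f (suc (suc n))
      ≡⟨ isolate (a n ℚ.* f (suc (suc n))) (b n ℚ.* f (suc n)) ⟩
    (a n ℚ.* f (suc (suc n)) ℚ.+ b n ℚ.* f (suc n)) ℚ.- b n ℚ.* f (suc n)
      ≡⟨ cong₂ (λ u v → u ℚ.- b n ℚ.* v) (trans (rec-f n) (trans (cong (c n ℚ.*_) e₀) (sym (rec-g n)))) e₁ ⟩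
    (a n ℚ.* g (suc (suc n)) ℚ.+ b n ℚ.* g (suc n)) ℚ.- b n ℚ.* g (suc n)
      ≡⟨ sym (isolate (a n ℚ.* g (suc (suc n))) (b n ℚ.* g (suc n))) ⟩
    a n ℚ.* g (suc (suc n))
      ∎)
    where
    open ≡-Reasoning
    isolate : ∀ x y → x ≡ (x ℚ.+ y) ℚ.- y
    isolate = ℚ-solve 2 (λ x y → x := (x :+ y) :- y) refl
  agree : ∀ n → f n ≡ g n × f (suc n) ≡ g (suc n)
  agree zero    = f₀ , f₁
  agree (suc n) = proj₂ (agree n) , step n (proj₁ (agree n)) (proj₂ (agree n))

-- Shifts are written constant-first (1ℤ + n, + 2 + n) because at n = + m these reduce
-- definitionally to + suc m and + suc (suc m), the form in which the binomial lemmas are stated.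
module _ where
  open import Data.Integer using (_+_; _*_; _-_)

  c₂ c₁ c₀ : ℤ → ℤ
  c₂ n = (1ℤ + n) * (1ℤ + n) * (1ℤ + n) * (1ℤ + n)
  c₁ n = (+ 3 + + 2 * n) * (+ 5 + + 9 * n + + 3 * (n * n))
  c₀ n = (+ 2 + n) * (+ 2 + n) * (+ 2 + n) * (+ 2 + n)

Recurrence : (ℕ → ℚ) → Set
Recurrence f = ∀ n → fromℤ (c₂ (+ n)) ℚ.* f (2 ℕ.+ n) ℚ.+ fromℤ (c₁ (+ n)) ℚ.* f (1 ℕ.+ n) ≡ fromℤ (c₀ (+ n)) ℚ.* f n

-- Creative telescoping for the sum

module _ where
  open import Data.Integer using (_+_; _*_; _-_)

  ρ : ℤ → ℤ → ℤ
  ρ n k = + 2 * (+ 3 + + 2 * n) * (k * k * k) * ((k - 1ℤ) * (k - 1ℤ) * (k - 1ℤ))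

  -- xᵢ = C(n+i,k), yᵢ = C(n+k+i,k), a = C(2k,k), a′ = C(2k+2,k+1), b′ = C(n+k+1,k+1),
  -- c′ = C(n+2,k+1), related by their hypergeometric ratios.  After multiplication by
  -- (n+1)(n+2) every one of them is a polynomial multiple of a y₀ x₂.
  zeilberger-identity : ∀ n k x₀ x₁ x₂ y₀ y₁ y₂ a a′ b′ c′ →
    (1ℤ + n) * x₀ ≡ (1ℤ + n - k) * x₁ →
    (+ 2 + n) * x₁ ≡ (+ 2 + n - k) * x₂ →
    (1ℤ + (n + k)) * y₀ ≡ (1ℤ + (n + k) - k) * y₁ →
    (+ 2 + (n + k)) * y₁ ≡ (+ 2 + (n + k) - k) * y₂ →
    (1ℤ + k) * a′ ≡ + 2 * (1ℤ + + 2 * k) * a →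
    (1ℤ + k) * b′ ≡ (1ℤ + (n + k)) * y₀ →
    (1ℤ + k) * c′ ≡ (+ 2 + n) * x₁ →
    (1ℤ + n) * (+ 2 + n) * (+ 4 * (c₂ n * (k * k * k * x₂ * y₂ * a) + c₁ n * (k * k * k * x₁ * y₁ * a) - c₀ n * (k * k * k * x₀ * y₀ * a)))
    ≡ (1ℤ + n) * (+ 2 + n) * (ρ n (1ℤ + k) * (a′ * b′ * c′) + + 4 * (ρ n k * (a * y₀ * x₂)))
  zeilberger-identity n k x₀ x₁ x₂ y₀ y₁ y₂ a a′ b′ c′ h₁ h₂ h₃ h₄ h₅ h₆ h₇ = begin
    N * (+ 4 * (c₂ n * (K * x₂ * y₂ * a) + c₁ n * (K * x₁ * y₁ * a) - c₀ n * (K * x₀ * y₀ * a)))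
      ≡⟨ rearrange (c₂ n) (c₁ n) (c₀ n) n k x₀ x₁ x₂ y₀ y₁ y₂ a ⟩
    + 4 * K * a * (c₂ n * x₂ * (N * y₂) + c₁ n * (N * (x₁ * y₁)) - c₀ n * y₀ * (N * x₀))
      ≡⟨ cong₂ (λ u v → + 4 * K * a * (c₂ n * x₂ * u + c₁ n * v - c₀ n * y₀ * (N * x₀))) e₂ e₁ ⟩
    + 4 * K * a * (c₂ n * x₂ * N*y₂ + c₁ n * N*x₁y₁ - c₀ n * y₀ * (N * x₀))
      ≡⟨ cong (λ w → + 4 * K * a * (c₂ n * x₂ * N*y₂ + c₁ n * N*x₁y₁ - c₀ n * y₀ * w)) e₀ ⟩
    + 4 * K * a * (c₂ n * x₂ * N*y₂ + c₁ n * N*x₁y₁ - c₀ n * y₀ * N*x₀)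
      ≡⟨ certificate-polynomial n k a y₀ x₂ ⟩
    N * (+ 2 * (+ 3 + + 2 * n) * K * [1+k]³a′b′c′ + + 4 * (ρ n k * (a * y₀ * x₂)))
      ≡⟨ cong (λ u → N * (+ 2 * (+ 3 + + 2 * n) * K * u + + 4 * (ρ n k * (a * y₀ * x₂)))) (sym e₃) ⟩
    N * (+ 2 * (+ 3 + + 2 * n) * K * ((1ℤ + k) * (1ℤ + k) * (1ℤ + k) * (a′ * b′ * c′)) + + 4 * (ρ n k * (a * y₀ * x₂)))
      ≡⟨ cong (λ u → N * (u + + 4 * (ρ n k * (a * y₀ * x₂)))) (ρ-shift n k (a′ * b′ * c′)) ⟩
    N * (ρ n (1ℤ + k) * (a′ * b′ * c′) + + 4 * (ρ n k * (a * y₀ * x₂)))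
      ∎
    where
    open ≡-Reasoning
    N K N*x₀ N*x₁y₁ N*y₂ [1+k]³a′b′c′ : ℤ
    N = (1ℤ + n) * (+ 2 + n)
    K = k * k * k
    N*x₀ = (1ℤ + n - k) * ((+ 2 + n - k) * x₂)
    N*x₁y₁ = ((+ 2 + n - k) * x₂) * ((1ℤ + (n + k)) * y₀)
    N*y₂ = (+ 2 + (n + k)) * ((1ℤ + (n + k)) * y₀)
    [1+k]³a′b′c′ = (+ 2 * (1ℤ + + 2 * k) * a) * ((1ℤ + (n + k)) * y₀) * ((+ 2 + n - k) * x₂)
    e₀ : N * x₀ ≡ N*x₀
    e₀ = begin
      (1ℤ + n) * (+ 2 + n) * x₀       ≡⟨ solve (n ∷ x₀ ∷ []) ⟩
      (+ 2 + n) * ((1ℤ + n) * x₀)     ≡⟨ cong ((+ 2 + n) *_) h₁ ⟩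
      (+ 2 + n) * ((1ℤ + n - k) * x₁) ≡⟨ solve (n ∷ k ∷ x₁ ∷ []) ⟩
      (1ℤ + n - k) * ((+ 2 + n) * x₁) ≡⟨ cong ((1ℤ + n - k) *_) h₂ ⟩
      (1ℤ + n - k) * ((+ 2 + n - k) * x₂) ∎
    e₁ : N * (x₁ * y₁) ≡ N*x₁y₁
    e₁ = begin
      (1ℤ + n) * (+ 2 + n) * (x₁ * y₁)                 ≡⟨ solve (n ∷ k ∷ x₁ ∷ y₁ ∷ []) ⟩
      ((+ 2 + n) * x₁) * ((1ℤ + (n + k) - k) * y₁)     ≡⟨ cong₂ _*_ h₂ (sym h₃) ⟩
      ((+ 2 + n - k) * x₂) * ((1ℤ + (n + k)) * y₀)     ∎
    e₂ : N * y₂ ≡ N*y₂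
    e₂ = begin
      (1ℤ + n) * (+ 2 + n) * y₂                        ≡⟨ solve (n ∷ k ∷ y₂ ∷ []) ⟩
      (1ℤ + n) * ((+ 2 + (n + k) - k) * y₂)            ≡⟨ cong ((1ℤ + n) *_) (sym h₄) ⟩
      (1ℤ + n) * ((+ 2 + (n + k)) * y₁)                ≡⟨ solve (n ∷ k ∷ y₁ ∷ []) ⟩
      (+ 2 + (n + k)) * ((1ℤ + (n + k) - k) * y₁)      ≡⟨ cong ((+ 2 + (n + k)) *_) (sym h₃) ⟩
      (+ 2 + (n + k)) * ((1ℤ + (n + k)) * y₀)          ∎
    e₃ : (1ℤ + k) * (1ℤ + k) * (1ℤ + k) * (a′ * b′ * c′) ≡ [1+k]³a′b′c′
    e₃ = begin
      (1ℤ + k) * (1ℤ + k) * (1ℤ + k) * (a′ * b′ * c′)            ≡⟨ solve (k ∷ a′ ∷ b′ ∷ c′ ∷ []) ⟩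
      ((1ℤ + k) * a′) * ((1ℤ + k) * b′) * ((1ℤ + k) * c′)        ≡⟨ cong₂ _*_ (cong₂ _*_ h₅ h₆) (trans h₇ h₂) ⟩
      (+ 2 * (1ℤ + + 2 * k) * a) * ((1ℤ + (n + k)) * y₀) * ((+ 2 + n - k) * x₂) ∎
    rearrange : ∀ C₂ C₁ C₀ n k x₀ x₁ x₂ y₀ y₁ y₂ a →
      (1ℤ + n) * (+ 2 + n) * (+ 4 * (C₂ * (k * k * k * x₂ * y₂ * a) + C₁ * (k * k * k * x₁ * y₁ * a) - C₀ * (k * k * k * x₀ * y₀ * a)))
      ≡ + 4 * (k * k * k) * a * (C₂ * x₂ * ((1ℤ + n) * (+ 2 + n) * y₂) + C₁ * ((1ℤ + n) * (+ 2 + n) * (x₁ * y₁))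
                                 - C₀ * y₀ * ((1ℤ + n) * (+ 2 + n) * x₀))
    rearrange = solve-∀
    certificate-polynomial : ∀ n k a y x →
      + 4 * (k * k * k) * a * (((1ℤ + n) * (1ℤ + n) * (1ℤ + n) * (1ℤ + n)) * x * ((+ 2 + (n + k)) * ((1ℤ + (n + k)) * y))
                               + ((+ 3 + + 2 * n) * (+ 5 + + 9 * n + + 3 * (n * n))) * (((+ 2 + n - k) * x) * ((1ℤ + (n + k)) * y))
                               - ((+ 2 + n) * (+ 2 + n) * (+ 2 + n) * (+ 2 + n)) * y * ((1ℤ + n - k) * ((+ 2 + n - k) * x)))
      ≡ (1ℤ + n) * (+ 2 + n) * (+ 2 * (+ 3 + + 2 * n) * (k * k * k) * ((+ 2 * (1ℤ + + 2 * k) * a) * ((1ℤ + (n + k)) * y) * ((+ 2 + n - k) * x))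
                                + + 4 * ((+ 2 * (+ 3 + + 2 * n) * (k * k * k) * ((k - 1ℤ) * (k - 1ℤ) * (k - 1ℤ))) * (a * y * x)))
    certificate-polynomial = solve-∀
    ρ-shift : ∀ n k X → + 2 * (+ 3 + + 2 * n) * (k * k * k) * ((1ℤ + k) * (1ℤ + k) * (1ℤ + k) * X)
                        ≡ (+ 2 * (+ 3 + + 2 * n) * ((1ℤ + k) * (1ℤ + k) * (1ℤ + k)) * (((1ℤ + k) - 1ℤ) * ((1ℤ + k) - 1ℤ) * ((1ℤ + k) - 1ℤ))) * X
    ρ-shift = solve-∀

certificate : ℕ → ℕ → ℚ
certificate n k = ((ℤ.- 1ℤ) ℤ.^ k ℤ.* ℤ.- (ρ (+ n) (+ k) ℤ.* (+ ((2 ℕ.* k) C k) ℤ.* + ((n ℕ.+ k) C k) ℤ.* + ((2 ℕ.+ n) C k)))) / 4 ℕ.^ k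
  where instance _ = ℕ.m^n≢0 4 k

+-cube : ∀ k x y z → + (k ℕ.^ 3 ℕ.* x ℕ.* y ℕ.* z) ≡ + k ℤ.* + k ℤ.* + k ℤ.* + x ℤ.* + y ℤ.* + z
+-cube k x y z = begin
  + (k ℕ.^ 3 ℕ.* x ℕ.* y ℕ.* z)                 ≡⟨ ℤ.pos-* (k ℕ.^ 3 ℕ.* x ℕ.* y) z ⟩
  + (k ℕ.^ 3 ℕ.* x ℕ.* y) ℤ.* + z               ≡⟨ cong (ℤ._* + z) (ℤ.pos-* (k ℕ.^ 3 ℕ.* x) y) ⟩
  + (k ℕ.^ 3 ℕ.* x) ℤ.* + y ℤ.* + z             ≡⟨ cong (λ u → u ℤ.* + y ℤ.* + z) (ℤ.pos-* (k ℕ.^ 3) x) ⟩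
  + (k ℕ.^ 3) ℤ.* + x ℤ.* + y ℤ.* + z           ≡⟨ cong (λ u → u ℤ.* + x ℤ.* + y ℤ.* + z) cube ⟩
  + k ℤ.* + k ℤ.* + k ℤ.* + x ℤ.* + y ℤ.* + z   ∎
  where
  open ≡-Reasoning
  cube : + (k ℕ.^ 3) ≡ + k ℤ.* + k ℤ.* + k
  cube = begin
    + (k ℕ.* (k ℕ.* (k ℕ.* 1)))   ≡⟨ cong (λ u → + (k ℕ.* (k ℕ.* u))) (ℕ.*-identityʳ k) ⟩
    + (k ℕ.* (k ℕ.* k))           ≡⟨ trans (ℤ.pos-* k (k ℕ.* k)) (cong (+ k ℤ.*_) (ℤ.pos-* k k)) ⟩
    + k ℤ.* (+ k ℤ.* + k)         ≡⟨ sym (ℤ.*-assoc (+ k) (+ k) (+ k)) ⟩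
    + k ℤ.* + k ℤ.* + k           ∎

signed-telescoping : ∀ s C₂ C₁ C₀ F₂ F₁ F₀ R′ R →
  + 4 ℤ.* (C₂ ℤ.* F₂ ℤ.+ C₁ ℤ.* F₁ ℤ.- C₀ ℤ.* F₀) ≡ R′ ℤ.+ + 4 ℤ.* R →
  + 4 ℤ.* (C₂ ℤ.* (s ℤ.* F₂) ℤ.+ C₁ ℤ.* (s ℤ.* F₁) ℤ.- C₀ ℤ.* (s ℤ.* F₀)) ≡ ℤ.- 1ℤ ℤ.* s ℤ.* ℤ.- R′ ℤ.- + 4 ℤ.* (s ℤ.* ℤ.- R)
signed-telescoping s C₂ C₁ C₀ F₂ F₁ F₀ R′ R eq = begin
  + 4 ℤ.* (C₂ ℤ.* (s ℤ.* F₂) ℤ.+ C₁ ℤ.* (s ℤ.* F₁) ℤ.- C₀ ℤ.* (s ℤ.* F₀))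
    ≡⟨ solve (s ∷ C₂ ∷ C₁ ∷ C₀ ∷ F₂ ∷ F₁ ∷ F₀ ∷ []) ⟩
  s ℤ.* (+ 4 ℤ.* (C₂ ℤ.* F₂ ℤ.+ C₁ ℤ.* F₁ ℤ.- C₀ ℤ.* F₀))
    ≡⟨ cong (s ℤ.*_) eq ⟩
  s ℤ.* (R′ ℤ.+ + 4 ℤ.* R)
    ≡⟨ solve (s ∷ R′ ∷ R ∷ []) ⟩
  ℤ.- 1ℤ ℤ.* s ℤ.* ℤ.- R′ ℤ.- + 4 ℤ.* (s ℤ.* ℤ.- R)
    ∎
  where open ≡-Reasoning

term-telescopes : ∀ n k →
  fromℤ (c₂ (+ n)) ℚ.* term (2 ℕ.+ n) k ℚ.+ fromℤ (c₁ (+ n)) ℚ.* term (1 ℕ.+ n) k ℚ.- fromℤ (c₀ (+ n)) ℚ.* term n k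
  ≡ certificate n (suc k) ℚ.- certificate n k
term-telescopes n k = begin
  fromℤ (c₂ (+ n)) ℚ.* term (2 ℕ.+ n) k ℚ.+ fromℤ (c₁ (+ n)) ℚ.* term (1 ℕ.+ n) k ℚ.- fromℤ (c₀ (+ n)) ℚ.* term n k
    ≡⟨ telescoping-fractions (c₂ (+ n)) (c₁ (+ n)) (c₀ (+ n)) (σ ℤ.* + F₂) (σ ℤ.* + F₁) (σ ℤ.* + F₀) G₁ G₀ (4 ℕ.^ k)
         (signed-telescoping σ (c₂ (+ n)) (c₁ (+ n)) (c₀ (+ n)) (+ F₂) (+ F₁) (+ F₀) _ _ (trans casts zeilberger)) ⟩
  G₁ / 4 ℕ.^ suc k ℚ.- G₀ / 4 ℕ.^ k
    ≡⟨ cong (λ m → (ℤ.- 1ℤ ℤ.* σ ℤ.* ℤ.- (ρ (+ n) (+ suc k) ℤ.* (a′ ℤ.* + (m C suc k) ℤ.* c′))) / 4 ℕ.^ suc k ℚ.- G₀ / 4 ℕ.^ k)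
            (sym (ℕ.+-suc n k)) ⟩
  certificate n (suc k) ℚ.- certificate n k
    ∎
  where
  open ≡-Reasoning
  instance
    _ = ℕ.m^n≢0 4 k
    _ = ℕ.m^n≢0 4 (suc k)
  σ x₀ x₁ x₂ y₀ y₁ y₂ a a′ b′ c′ : ℤ
  F₀ F₁ F₂ : ℕ
  σ = (ℤ.- 1ℤ) ℤ.^ k
  F₀ = k ℕ.^ 3 ℕ.* (n C k) ℕ.* ((n ℕ.+ k) C k) ℕ.* ((2 ℕ.* k) C k)
  F₁ = k ℕ.^ 3 ℕ.* (suc n C k) ℕ.* ((suc n ℕ.+ k) C k) ℕ.* ((2 ℕ.* k) C k)
  F₂ = k ℕ.^ 3 ℕ.* (suc (suc n) C k) ℕ.* ((suc (suc n) ℕ.+ k) C k) ℕ.* ((2 ℕ.* k) C k)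
  x₀ = + (n C k)
  x₁ = + (suc n C k)
  x₂ = + (suc (suc n) C k)
  y₀ = + ((n ℕ.+ k) C k)
  y₁ = + (suc (n ℕ.+ k) C k)
  y₂ = + (suc (suc (n ℕ.+ k)) C k)
  a  = + ((2 ℕ.* k) C k)
  a′ = + ((2 ℕ.* suc k) C suc k)
  b′ = + (suc (n ℕ.+ k) C suc k)
  c′ = + (suc (suc n) C suc k)
  G₀ G₁ : ℤ
  G₀ = σ ℤ.* ℤ.- (ρ (+ n) (+ k) ℤ.* (a ℤ.* y₀ ℤ.* x₂))
  G₁ = ℤ.- 1ℤ ℤ.* σ ℤ.* ℤ.- (ρ (+ n) (+ suc k) ℤ.* (a′ ℤ.* b′ ℤ.* c′))
  casts : + 4 ℤ.* (c₂ (+ n) ℤ.* + F₂ ℤ.+ c₁ (+ n) ℤ.* + F₁ ℤ.- c₀ (+ n) ℤ.* + F₀)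
        ≡ + 4 ℤ.* (c₂ (+ n) ℤ.* (+ k ℤ.* + k ℤ.* + k ℤ.* x₂ ℤ.* y₂ ℤ.* a) ℤ.+ c₁ (+ n) ℤ.* (+ k ℤ.* + k ℤ.* + k ℤ.* x₁ ℤ.* y₁ ℤ.* a)
                   ℤ.- c₀ (+ n) ℤ.* (+ k ℤ.* + k ℤ.* + k ℤ.* x₀ ℤ.* y₀ ℤ.* a))
  casts = cong (+ 4 ℤ.*_) (cong₂ ℤ._-_ (cong₂ ℤ._+_ (cong (c₂ (+ n) ℤ.*_) (+-cube k _ _ _)) (cong (c₁ (+ n) ℤ.*_) (+-cube k _ _ _)))
                                       (cong (c₀ (+ n) ℤ.*_) (+-cube k _ _ _)))
  zeilberger : + 4 ℤ.* (c₂ (+ n) ℤ.* (+ k ℤ.* + k ℤ.* + k ℤ.* x₂ ℤ.* y₂ ℤ.* a) ℤ.+ c₁ (+ n) ℤ.* (+ k ℤ.* + k ℤ.* + k ℤ.* x₁ ℤ.* y₁ ℤ.* a)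
                         ℤ.- c₀ (+ n) ℤ.* (+ k ℤ.* + k ℤ.* + k ℤ.* x₀ ℤ.* y₀ ℤ.* a))
             ≡ ρ (+ n) (+ suc k) ℤ.* (a′ ℤ.* b′ ℤ.* c′) ℤ.+ + 4 ℤ.* (ρ (+ n) (+ k) ℤ.* (a ℤ.* y₀ ℤ.* x₂))
  zeilberger = ℤ.*-cancelˡ-≡ (+ suc n ℤ.* + suc (suc n)) _ _
    (zeilberger-identity (+ n) (+ k) x₀ x₁ x₂ y₀ y₁ y₂ a a′ b′ c′
      (C-row-ratio n k) (C-row-ratio (suc n) k) (C-row-ratio (n ℕ.+ k) k) (C-row-ratio (suc (n ℕ.+ k)) k)
      (C-central-ratio k) (C-absorption (n ℕ.+ k) k) (C-absorption (suc n) k))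

term-vanishes : ∀ {n k} → n ℕ.< k → term n k ≡ 0ℚ
term-vanishes {n} {k} n<k = i≡0⇒i/n≡0 (4 ℕ.^ k) {{ℕ.m^n≢0 4 k}} (begin
  (ℤ.- 1ℤ) ℤ.^ k ℤ.* + (k ℕ.^ 3 ℕ.* (n C k) ℕ.* ((n ℕ.+ k) C k) ℕ.* ((2 ℕ.* k) C k))
    ≡⟨ cong (λ c → (ℤ.- 1ℤ) ℤ.^ k ℤ.* + (k ℕ.^ 3 ℕ.* c ℕ.* ((n ℕ.+ k) C k) ℕ.* ((2 ℕ.* k) C k))) (k>n⇒nCk≡0 n<k) ⟩
  (ℤ.- 1ℤ) ℤ.^ k ℤ.* + (k ℕ.^ 3 ℕ.* 0 ℕ.* ((n ℕ.+ k) C k) ℕ.* ((2 ℕ.* k) C k))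
    ≡⟨ cong (λ m → (ℤ.- 1ℤ) ℤ.^ k ℤ.* + (m ℕ.* ((n ℕ.+ k) C k) ℕ.* ((2 ℕ.* k) C k))) (ℕ.*-zeroʳ (k ℕ.^ 3)) ⟩
  (ℤ.- 1ℤ) ℤ.^ k ℤ.* 0ℤ
    ≡⟨ ℤ.*-zeroʳ ((ℤ.- 1ℤ) ℤ.^ k) ⟩
  0ℤ
    ∎)
  where open ≡-Reasoning

certificate-zero : ∀ n → certificate n 0 ≡ 0ℚ
certificate-zero n = i≡0⇒i/n≡0 1 (vanishes-at-0 (+ n) _)
  where
  vanishes-at-0 : ∀ n x → 1ℤ ℤ.* ℤ.- (+ 2 ℤ.* (+ 3 ℤ.+ + 2 ℤ.* n) ℤ.* (+ 0 ℤ.* + 0 ℤ.* + 0)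
                                     ℤ.* ((+ 0 ℤ.- 1ℤ) ℤ.* (+ 0 ℤ.- 1ℤ) ℤ.* (+ 0 ℤ.- 1ℤ)) ℤ.* x) ≡ + 0
  vanishes-at-0 = solve-∀

certificate-vanishes : ∀ {n k} → 2 ℕ.+ n ℕ.< k → certificate n k ≡ 0ℚ
certificate-vanishes {n} {k} n+2<k = i≡0⇒i/n≡0 (4 ℕ.^ k) {{ℕ.m^n≢0 4 k}}
  (trans (cong (λ c → (ℤ.- 1ℤ) ℤ.^ k ℤ.* ℤ.- (ρ (+ n) (+ k) ℤ.* (+ ((2 ℕ.* k) C k) ℤ.* + ((n ℕ.+ k) C k) ℤ.* + c)))
               (k>n⇒nCk≡0 n+2<k))
         (absorbs-zero ((ℤ.- 1ℤ) ℤ.^ k) (ρ (+ n) (+ k)) (+ ((2 ℕ.* k) C k)) (+ ((n ℕ.+ k) C k))))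
  where
  absorbs-zero : ∀ s r a b → s ℤ.* ℤ.- (r ℤ.* (a ℤ.* b ℤ.* + 0)) ≡ + 0
  absorbs-zero = solve-∀

lhs-recurrence : Recurrence lhs
lhs-recurrence n = p-q≡0⇒p≡q (begin
  α ℚ.* lhs (2 ℕ.+ n) ℚ.+ β ℚ.* lhs (1 ℕ.+ n) ℚ.- γ ℚ.* lhs n
    ≡⟨ cong₂ (λ u v → α ℚ.* u ℚ.+ β ℚ.* v ℚ.- γ ℚ.* lhs n)
             (Σ≤≡Σ< (2 ℕ.+ n) t₂) (trans (Σ≤≡Σ< (1 ℕ.+ n) t₁) (Σ<-pad N₁ t₁ (term-vanishes (ℕ.n<1+n (suc n))))) ⟩
  α ℚ.* Σ< N t₂ ℚ.+ β ℚ.* Σ< N t₁ ℚ.- γ ℚ.* lhs n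
    ≡⟨ cong (λ u → α ℚ.* Σ< N t₂ ℚ.+ β ℚ.* Σ< N t₁ ℚ.- γ ℚ.* u)
            (trans (Σ≤≡Σ< n t₀) (trans (Σ<-pad (suc n) t₀ (term-vanishes (ℕ.n<1+n n))) (Σ<-pad N₁ t₀ (term-vanishes (ℕ.m<n⇒m<1+n (ℕ.n<1+n n)))))) ⟩
  α ℚ.* Σ< N t₂ ℚ.+ β ℚ.* Σ< N t₁ ℚ.- γ ℚ.* Σ< N t₀
    ≡⟨ sym (Σ<-linear N α β γ t₂ t₁ t₀) ⟩
  Σ< N (λ k → α ℚ.* t₂ k ℚ.+ β ℚ.* t₁ k ℚ.- γ ℚ.* t₀ k)
    ≡⟨ Σ<-cong N (term-telescopes n) ⟩
  Σ< N (λ k → certificate n (suc k) ℚ.- certificate n k)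
    ≡⟨ Σ<-telescope N (certificate n) ⟩
  certificate n N ℚ.- certificate n 0
    ≡⟨ cong₂ ℚ._-_ (certificate-vanishes (ℕ.n<1+n N₁)) (certificate-zero n) ⟩
  0ℚ ℚ.- 0ℚ
    ≡⟨⟩
  0ℚ
    ∎)
  where
  open ≡-Reasoning
  α β γ : ℚ
  t₂ t₁ t₀ : ℕ → ℚ
  N₁ N : ℕ
  α = fromℤ (c₂ (+ n))
  β = fromℤ (c₁ (+ n))
  γ = fromℤ (c₀ (+ n))
  t₂ = term (2 ℕ.+ n)
  t₁ = term (1 ℕ.+ n)
  t₀ = term n
  N₁ = 2 ℕ.+ n
  N = 3 ℕ.+ n

-- The closed form

by-parity : (P : ℕ → Set) → (∀ m → P (2 ℕ.* m)) → (∀ m → P (suc (2 ℕ.* m))) → ∀ n → P n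
by-parity P even odd zero    = even 0
by-parity P even odd (suc n) = by-parity (P ∘ suc) odd (λ m → subst P (ℕ.*-suc 2 m) (even (suc m))) n

double/2 : ∀ m → (2 ℕ.* m) ℕ./ 2 ≡ m
double/2 m = trans (/-congˡ (ℕ.*-comm 2 m)) (m*n/n≡m m 2)

1+double/2 : ∀ m → suc (2 ℕ.* m) ℕ./ 2 ≡ m
1+double/2 m = trans (+-distrib-/-∣ʳ 1 {d = 2} (m∣m*n m)) (double/2 m)

double%2 : ∀ m → (2 ℕ.* m) ℕ.% 2 ≡ 0
double%2 m = trans (%-congˡ (ℕ.*-comm 2 m)) (m*n%n≡0 m 2)

1+double%2 : ∀ m → suc (2 ℕ.* m) ℕ.% 2 ≡ 1
1+double%2 m = %-remove-+ʳ 1 {d = 2} (m∣m*n m)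

+-square : ∀ a → + (a ℕ.^ 2) ≡ + a ℤ.* + a
+-square a = trans (ℤ.pos-* a (a ℕ.* 1)) (cong (λ b → + a ℤ.* + b) (ℕ.*-identityʳ a))

-- The recurrence at n = 2m and n = 2m+1 over the common denominator 16^(m+1)·15,
-- with D = C(2m,m) and D′ = C(2m+2,m+1).
module _ where
  open import Data.Integer using (_+_; _*_; _-_; -_)

  evenPoly oddPoly : ℤ → ℤ
  evenPoly x = x * x * ((x + 1ℤ) * (x + 1ℤ)) * ((+ 2 * x + 1ℤ) * (+ 2 * x + 1ℤ))
  oddPoly x = - (x * x * (+ 4 * (x * x * x * x) + + 8 * (x * x * x) + + 3 * (x * x) - x + + 1))

  even-identity : ∀ M D D′ → (1ℤ + M) * D′ ≡ + 2 * (1ℤ + + 2 * M) * D →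
    c₂ (+ 2 * M) * (D′ * D′ * evenPoly (+ 2 * (1ℤ + M))) + c₁ (+ 2 * M) * (+ 16 * (D * D * oddPoly (1ℤ + + 2 * M)))
    ≡ c₀ (+ 2 * M) * (+ 16 * (D * D * evenPoly (+ 2 * M)))
  even-identity M D D′ h = begin
    c₂ (+ 2 * M) * (D′ * D′ * evenPoly (+ 2 * (1ℤ + M))) + Z  ≡⟨ expose (c₂ (+ 2 * M)) M D′ Z ⟩
    + 4 * c₂ (+ 2 * M) * W * ((1ℤ + M) * D′ * ((1ℤ + M) * D′)) + Z  ≡⟨ cong (λ u → + 4 * c₂ (+ 2 * M) * W * (u * u) + Z) h ⟩
    + 4 * c₂ (+ 2 * M) * W * (+ 2 * (1ℤ + + 2 * M) * D * (+ 2 * (1ℤ + + 2 * M) * D)) + Z  ≡⟨ polynomial M D ⟩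
    c₀ (+ 2 * M) * (+ 16 * (D * D * evenPoly (+ 2 * M)))  ∎
    where
    open ≡-Reasoning
    Z W : ℤ
    Z = c₁ (+ 2 * M) * (+ 16 * (D * D * oddPoly (1ℤ + + 2 * M)))
    W = (+ 3 + + 2 * M) * (+ 3 + + 2 * M) * (+ 5 + + 4 * M) * (+ 5 + + 4 * M)
    expose : ∀ C M D′ Z → C * (D′ * D′ * ((+ 2 * (1ℤ + M)) * (+ 2 * (1ℤ + M)) * (((+ 2 * (1ℤ + M)) + 1ℤ) * ((+ 2 * (1ℤ + M)) + 1ℤ)) * ((+ 2 * (+ 2 * (1ℤ + M)) + 1ℤ) * (+ 2 * (+ 2 * (1ℤ + M)) + 1ℤ)))) + Z
                          ≡ + 4 * C * ((+ 3 + + 2 * M) * (+ 3 + + 2 * M) * (+ 5 + + 4 * M) * (+ 5 + + 4 * M)) * ((1ℤ + M) * D′ * ((1ℤ + M) * D′)) + Z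
    expose = solve-∀
    polynomial : ∀ M D →
      + 4 * ((1ℤ + (+ 2 * M)) * (1ℤ + (+ 2 * M)) * (1ℤ + (+ 2 * M)) * (1ℤ + (+ 2 * M))) * ((+ 3 + + 2 * M) * (+ 3 + + 2 * M) * (+ 5 + + 4 * M) * (+ 5 + + 4 * M)) * (+ 2 * (1ℤ + + 2 * M) * D * (+ 2 * (1ℤ + + 2 * M) * D))
        + ((+ 3 + + 2 * (+ 2 * M)) * (+ 5 + + 9 * (+ 2 * M) + + 3 * ((+ 2 * M) * (+ 2 * M)))) * (+ 16 * (D * D * (- ((1ℤ + + 2 * M) * (1ℤ + + 2 * M) * (+ 4 * ((1ℤ + + 2 * M) * (1ℤ + + 2 * M) * (1ℤ + + 2 * M) * (1ℤ + + 2 * M)) + + 8 * ((1ℤ + + 2 * M) * (1ℤ + + 2 * M) * (1ℤ + + 2 * M)) + + 3 * ((1ℤ + + 2 * M) * (1ℤ + + 2 * M)) - (1ℤ + + 2 * M) + + 1)))))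
      ≡ ((+ 2 + (+ 2 * M)) * (+ 2 + (+ 2 * M)) * (+ 2 + (+ 2 * M)) * (+ 2 + (+ 2 * M))) * (+ 16 * (D * D * ((+ 2 * M) * (+ 2 * M) * (((+ 2 * M) + 1ℤ) * ((+ 2 * M) + 1ℤ)) * ((+ 2 * (+ 2 * M) + 1ℤ) * (+ 2 * (+ 2 * M) + 1ℤ)))))
    polynomial = solve-∀

  odd-identity : ∀ M D D′ → (1ℤ + M) * D′ ≡ + 2 * (1ℤ + + 2 * M) * D →
    c₂ (1ℤ + + 2 * M) * (D′ * D′ * oddPoly (1ℤ + + 2 * (1ℤ + M))) + c₁ (1ℤ + + 2 * M) * (D′ * D′ * evenPoly (+ 2 * (1ℤ + M)))
    ≡ c₀ (1ℤ + + 2 * M) * (+ 16 * (D * D * oddPoly (1ℤ + + 2 * M)))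
  odd-identity M D D′ h = begin
    c₂ (1ℤ + + 2 * M) * (D′ * D′ * oddPoly (1ℤ + + 2 * (1ℤ + M))) + c₁ (1ℤ + + 2 * M) * (D′ * D′ * evenPoly (+ 2 * (1ℤ + M)))
      ≡⟨ expose M D′ ⟩
    P * ((1ℤ + M) * D′ * ((1ℤ + M) * D′))  ≡⟨ cong (λ u → P * (u * u)) h ⟩
    P * (+ 2 * (1ℤ + + 2 * M) * D * (+ 2 * (1ℤ + + 2 * M) * D))  ≡⟨ polynomial M D ⟩
    c₀ (1ℤ + + 2 * M) * (+ 16 * (D * D * oddPoly (1ℤ + + 2 * M)))  ∎
    where
    open ≡-Reasoning
    W P : ℤ
    W = (+ 3 + + 2 * M) * (+ 3 + + 2 * M) * (+ 5 + + 4 * M) * (+ 5 + + 4 * M)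
    P = + 16 * ((1ℤ + M) * (1ℤ + M)) * oddPoly (1ℤ + + 2 * (1ℤ + M)) + + 4 * c₁ (1ℤ + + 2 * M) * W
    expose : ∀ M D′ →
      ((1ℤ + (1ℤ + + 2 * M)) * (1ℤ + (1ℤ + + 2 * M)) * (1ℤ + (1ℤ + + 2 * M)) * (1ℤ + (1ℤ + + 2 * M))) * (D′ * D′ * (- ((1ℤ + + 2 * (1ℤ + M)) * (1ℤ + + 2 * (1ℤ + M)) * (+ 4 * ((1ℤ + + 2 * (1ℤ + M)) * (1ℤ + + 2 * (1ℤ + M)) * (1ℤ + + 2 * (1ℤ + M)) * (1ℤ + + 2 * (1ℤ + M))) + + 8 * ((1ℤ + + 2 * (1ℤ + M)) * (1ℤ + + 2 * (1ℤ + M)) * (1ℤ + + 2 * (1ℤ + M))) + + 3 * ((1ℤ + + 2 * (1ℤ + M)) * (1ℤ + + 2 * (1ℤ + M))) - (1ℤ + + 2 * (1ℤ + M)) + + 1))))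
        + ((+ 3 + + 2 * (1ℤ + + 2 * M)) * (+ 5 + + 9 * (1ℤ + + 2 * M) + + 3 * ((1ℤ + + 2 * M) * (1ℤ + + 2 * M)))) * (D′ * D′ * ((+ 2 * (1ℤ + M)) * (+ 2 * (1ℤ + M)) * (((+ 2 * (1ℤ + M)) + 1ℤ) * ((+ 2 * (1ℤ + M)) + 1ℤ)) * ((+ 2 * (+ 2 * (1ℤ + M)) + 1ℤ) * (+ 2 * (+ 2 * (1ℤ + M)) + 1ℤ))))
      ≡ (+ 16 * ((1ℤ + M) * (1ℤ + M)) * (- ((1ℤ + + 2 * (1ℤ + M)) * (1ℤ + + 2 * (1ℤ + M)) * (+ 4 * ((1ℤ + + 2 * (1ℤ + M)) * (1ℤ + + 2 * (1ℤ + M)) * (1ℤ + + 2 * (1ℤ + M)) * (1ℤ + + 2 * (1ℤ + M))) + + 8 * ((1ℤ + + 2 * (1ℤ + M)) * (1ℤ + + 2 * (1ℤ + M)) * (1ℤ + + 2 * (1ℤ + M))) + + 3 * ((1ℤ + + 2 * (1ℤ + M)) * (1ℤ + + 2 * (1ℤ + M))) - (1ℤ + + 2 * (1ℤ + M)) + + 1)))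
         + + 4 * ((+ 3 + + 2 * (1ℤ + + 2 * M)) * (+ 5 + + 9 * (1ℤ + + 2 * M) + + 3 * ((1ℤ + + 2 * M) * (1ℤ + + 2 * M)))) * ((+ 3 + + 2 * M) * (+ 3 + + 2 * M) * (+ 5 + + 4 * M) * (+ 5 + + 4 * M))) * ((1ℤ + M) * D′ * ((1ℤ + M) * D′))
    expose = solve-∀
    polynomial : ∀ M D → (+ 16 * ((1ℤ + M) * (1ℤ + M)) * (- ((1ℤ + + 2 * (1ℤ + M)) * (1ℤ + + 2 * (1ℤ + M)) * (+ 4 * ((1ℤ + + 2 * (1ℤ + M)) * (1ℤ + + 2 * (1ℤ + M)) * (1ℤ + + 2 * (1ℤ + M)) * (1ℤ + + 2 * (1ℤ + M))) + + 8 * ((1ℤ + + 2 * (1ℤ + M)) * (1ℤ + + 2 * (1ℤ + M)) * (1ℤ + + 2 * (1ℤ + M))) + + 3 * ((1ℤ + + 2 * (1ℤ + M)) * (1ℤ + + 2 * (1ℤ + M))) - (1ℤ + + 2 * (1ℤ + M)) + + 1)))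
         + + 4 * ((+ 3 + + 2 * (1ℤ + + 2 * M)) * (+ 5 + + 9 * (1ℤ + + 2 * M) + + 3 * ((1ℤ + + 2 * M) * (1ℤ + + 2 * M)))) * ((+ 3 + + 2 * M) * (+ 3 + + 2 * M) * (+ 5 + + 4 * M) * (+ 5 + + 4 * M))) * (+ 2 * (1ℤ + + 2 * M) * D * (+ 2 * (1ℤ + + 2 * M) * D))
                         ≡ ((+ 2 + (1ℤ + + 2 * M)) * (+ 2 + (1ℤ + + 2 * M)) * (+ 2 + (1ℤ + + 2 * M)) * (+ 2 + (1ℤ + + 2 * M))) * (+ 16 * (D * D * (- ((1ℤ + + 2 * M) * (1ℤ + + 2 * M) * (+ 4 * ((1ℤ + + 2 * M) * (1ℤ + + 2 * M) * (1ℤ + + 2 * M) * (1ℤ + + 2 * M)) + + 8 * ((1ℤ + + 2 * M) * (1ℤ + + 2 * M) * (1ℤ + + 2 * M)) + + 3 * ((1ℤ + + 2 * M) * (1ℤ + + 2 * M)) - (1ℤ + + 2 * M) + + 1)))))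
    polynomial = solve-∀

poly15-even : ∀ n → n ℕ.% 2 ≡ 0 → poly15 n ≡ evenPoly (+ n)
poly15-even n n%2≡0 with n ℕ.% 2
... | 0 = begin
  + (n ℕ.^ 2 ℕ.* (n ℕ.+ 1) ℕ.^ 2 ℕ.* (2 ℕ.* n ℕ.+ 1) ℕ.^ 2)
    ≡⟨ ℤ.pos-* (n ℕ.^ 2 ℕ.* (n ℕ.+ 1) ℕ.^ 2) ((2 ℕ.* n ℕ.+ 1) ℕ.^ 2) ⟩
  + (n ℕ.^ 2 ℕ.* (n ℕ.+ 1) ℕ.^ 2) ℤ.* + ((2 ℕ.* n ℕ.+ 1) ℕ.^ 2)
    ≡⟨ cong (ℤ._* + ((2 ℕ.* n ℕ.+ 1) ℕ.^ 2)) (ℤ.pos-* (n ℕ.^ 2) ((n ℕ.+ 1) ℕ.^ 2)) ⟩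
  + (n ℕ.^ 2) ℤ.* + ((n ℕ.+ 1) ℕ.^ 2) ℤ.* + ((2 ℕ.* n ℕ.+ 1) ℕ.^ 2)
    ≡⟨ cong₂ ℤ._*_ (cong₂ ℤ._*_ (+-square n) (+-square (n ℕ.+ 1))) (+-square (2 ℕ.* n ℕ.+ 1)) ⟩
  + n ℤ.* + n ℤ.* (+ (n ℕ.+ 1) ℤ.* + (n ℕ.+ 1)) ℤ.* (+ (2 ℕ.* n ℕ.+ 1) ℤ.* + (2 ℕ.* n ℕ.+ 1))
    ≡⟨ cong₂ (λ u v → + n ℤ.* + n ℤ.* (u ℤ.* u) ℤ.* (v ℤ.* v)) (ℤ.pos-+ n 1) (trans (ℤ.pos-+ (2 ℕ.* n) 1) (cong (ℤ._+ 1ℤ) (ℤ.pos-* 2 n))) ⟩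
  evenPoly (+ n)
    ∎
  where open ≡-Reasoning

poly15-odd : ∀ n → n ℕ.% 2 ≡ 1 → poly15 n ≡ oddPoly (+ n)
poly15-odd n n%2≡1 with n ℕ.% 2
... | 1 = trans (cong (λ s → ℤ.- (s ℤ.* (+ 4 ℤ.* (+ n) ℤ.^ 4 ℤ.+ + 8 ℤ.* (+ n) ℤ.^ 3 ℤ.+ + 3 ℤ.* (+ n) ℤ.^ 2 ℤ.- (+ n) ℤ.+ + 1))) (+-square n))
          (powers (+ n))
  where
  open import Data.Integer using (_+_; _*_; _-_; -_)
  powers : ∀ x → - (x * x * (+ 4 * (x * (x * (x * (x * 1ℤ)))) + + 8 * (x * (x * (x * 1ℤ))) + + 3 * (x * (x * 1ℤ)) - x + + 1))
                 ≡ - (x * x * (+ 4 * (x * x * x * x) + + 8 * (x * x * x) + + 3 * (x * x) - x + + 1))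
  powers = solve-∀

centralBinomial : ℕ → ℕ
centralBinomial m = (2 ℕ.* m) C m

_/16^_·15 : ℤ → ℕ → ℚ
i /16^ m ·15 = (i / (16 ℕ.^ m ℕ.* 15)) {{ℕ.m*n≢0 (16 ℕ.^ m) 15 {{ℕ.m^n≢0 16 m}}}}

rhs-at-half : ∀ n m → n ℕ./ 2 ≡ m → rhs n ≡ (+ centralBinomial m ℤ.* + centralBinomial m ℤ.* poly15 n) /16^ m ·15
rhs-at-half n m n/2≡m = cong₂ _/16^_·15
  (cong (ℤ._* poly15 n) (trans (cong (λ h → + (centralBinomial h ℕ.^ 2)) n/2≡m) (+-square (centralBinomial m))))
  n/2≡m

rhs-even : ∀ m → rhs (2 ℕ.* m) ≡ (+ centralBinomial m ℤ.* + centralBinomial m ℤ.* evenPoly (+ 2 ℤ.* + m)) /16^ m ·15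
rhs-even m = trans (rhs-at-half (2 ℕ.* m) m (double/2 m))
  (cong (λ p → (+ centralBinomial m ℤ.* + centralBinomial m ℤ.* p) /16^ m ·15)
        (trans (poly15-even (2 ℕ.* m) (double%2 m)) (cong evenPoly (ℤ.pos-* 2 m))))

rhs-odd : ∀ m → rhs (suc (2 ℕ.* m)) ≡ (+ centralBinomial m ℤ.* + centralBinomial m ℤ.* oddPoly (1ℤ ℤ.+ + 2 ℤ.* + m)) /16^ m ·15
rhs-odd m = trans (rhs-at-half (suc (2 ℕ.* m)) m (1+double/2 m))
  (cong (λ p → (+ centralBinomial m ℤ.* + centralBinomial m ℤ.* p) /16^ m ·15)
        (trans (poly15-odd (suc (2 ℕ.* m)) (1+double%2 m)) (cong (λ t → oddPoly (1ℤ ℤ.+ t)) (ℤ.pos-* 2 m))))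

/16^·15-suc : ∀ i m → i /16^ m ·15 ≡ (+ 16 ℤ.* i) /16^ suc m ·15
/16^·15-suc i m = trans (/-scale 16 i (16 ℕ.^ m ℕ.* 15) {{_}} {{ℕ.m*n≢0 (16 ℕ.^ m) 15 {{ℕ.m^n≢0 16 m}}}})
  (ℚ./-cong {+ 16 ℤ.* i} {_} {+ 16 ℤ.* i} {{ℕ.m*n≢0 16 (16 ℕ.^ m ℕ.* 15) {{_}} {{ℕ.m*n≢0 (16 ℕ.^ m) 15 {{ℕ.m^n≢0 16 m}}}}}}
            {{ℕ.m*n≢0 (16 ℕ.^ suc m) 15 {{ℕ.m^n≢0 16 (suc m)}}}} refl (sym (ℕ.*-assoc 16 (16 ℕ.^ m) 15)))

rhs-recurrence : Recurrence rhs
rhs-recurrence = by-parity _ even odd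
  where
  open ≡-Reasoning
  even : ∀ m → fromℤ (c₂ (+ (2 ℕ.* m))) ℚ.* rhs (2 ℕ.+ 2 ℕ.* m) ℚ.+ fromℤ (c₁ (+ (2 ℕ.* m))) ℚ.* rhs (1 ℕ.+ 2 ℕ.* m)
               ≡ fromℤ (c₀ (+ (2 ℕ.* m))) ℚ.* rhs (2 ℕ.* m)
  even m = begin
    fromℤ (c₂ N) ℚ.* rhs (2 ℕ.+ 2 ℕ.* m) ℚ.+ fromℤ (c₁ N) ℚ.* rhs (1 ℕ.+ 2 ℕ.* m)
      ≡⟨ cong₂ (λ u v → fromℤ (c₂ N) ℚ.* u ℚ.+ fromℤ (c₁ N) ℚ.* v)
               (trans (cong rhs (sym (ℕ.*-suc 2 m))) (rhs-even (suc m))) (trans (rhs-odd m) (/16^·15-suc X₁ m)) ⟩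
    fromℤ (c₂ N) ℚ.* (X₂ /16^ suc m ·15) ℚ.+ fromℤ (c₁ N) ℚ.* ((+ 16 ℤ.* X₁) /16^ suc m ·15)
      ≡⟨ fraction-combination (c₂ N) (c₁ N) (c₀ N) X₂ (+ 16 ℤ.* X₁) (+ 16 ℤ.* X₀) (16 ℕ.^ suc m ℕ.* 15)
           (subst (λ N → c₂ N ℤ.* X₂ ℤ.+ c₁ N ℤ.* (+ 16 ℤ.* X₁) ≡ c₀ N ℤ.* (+ 16 ℤ.* X₀)) (sym (ℤ.pos-* 2 m))
                  (even-identity (+ m) D D′ (C-central-ratio m))) ⟩
    fromℤ (c₀ N) ℚ.* ((+ 16 ℤ.* X₀) /16^ suc m ·15)
      ≡⟨ cong (fromℤ (c₀ N) ℚ.*_) (sym (trans (rhs-even m) (/16^·15-suc X₀ m))) ⟩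
    fromℤ (c₀ N) ℚ.* rhs (2 ℕ.* m)
      ∎
    where
    N D D′ X₀ X₁ X₂ : ℤ
    N = + (2 ℕ.* m)
    instance _ = ℕ.m*n≢0 (16 ℕ.^ suc m) 15 {{ℕ.m^n≢0 16 (suc m)}}
    D = + centralBinomial m
    D′ = + centralBinomial (suc m)
    X₀ = D ℤ.* D ℤ.* evenPoly (+ 2 ℤ.* + m)
    X₁ = D ℤ.* D ℤ.* oddPoly (1ℤ ℤ.+ + 2 ℤ.* + m)
    X₂ = D′ ℤ.* D′ ℤ.* evenPoly (+ 2 ℤ.* + suc m)
  odd : ∀ m → fromℤ (c₂ (+ suc (2 ℕ.* m))) ℚ.* rhs (3 ℕ.+ 2 ℕ.* m) ℚ.+ fromℤ (c₁ (+ suc (2 ℕ.* m))) ℚ.* rhs (2 ℕ.+ 2 ℕ.* m)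
              ≡ fromℤ (c₀ (+ suc (2 ℕ.* m))) ℚ.* rhs (suc (2 ℕ.* m))
  odd m = begin
    fromℤ (c₂ N) ℚ.* rhs (3 ℕ.+ 2 ℕ.* m) ℚ.+ fromℤ (c₁ N) ℚ.* rhs (2 ℕ.+ 2 ℕ.* m)
      ≡⟨ cong₂ (λ u v → fromℤ (c₂ N) ℚ.* u ℚ.+ fromℤ (c₁ N) ℚ.* v)
               (trans (cong (rhs ∘ suc) (sym (ℕ.*-suc 2 m))) (rhs-odd (suc m))) (trans (cong rhs (sym (ℕ.*-suc 2 m))) (rhs-even (suc m))) ⟩
    fromℤ (c₂ N) ℚ.* (X₂ /16^ suc m ·15) ℚ.+ fromℤ (c₁ N) ℚ.* (X₁ /16^ suc m ·15)
      ≡⟨ fraction-combination (c₂ N) (c₁ N) (c₀ N) X₂ X₁ (+ 16 ℤ.* X₀) (16 ℕ.^ suc m ℕ.* 15)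
           (subst (λ N → c₂ N ℤ.* X₂ ℤ.+ c₁ N ℤ.* X₁ ≡ c₀ N ℤ.* (+ 16 ℤ.* X₀)) (sym (cong (λ t → 1ℤ ℤ.+ t) (ℤ.pos-* 2 m)))
                  (odd-identity (+ m) D D′ (C-central-ratio m))) ⟩
    fromℤ (c₀ N) ℚ.* ((+ 16 ℤ.* X₀) /16^ suc m ·15)
      ≡⟨ cong (fromℤ (c₀ N) ℚ.*_) (sym (trans (rhs-odd m) (/16^·15-suc X₀ m))) ⟩
    fromℤ (c₀ N) ℚ.* rhs (suc (2 ℕ.* m))
      ∎
    where
    N D D′ X₀ X₁ X₂ : ℤ
    N = + suc (2 ℕ.* m)
    instance _ = ℕ.m*n≢0 (16 ℕ.^ suc m) 15 {{ℕ.m^n≢0 16 (suc m)}}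
    D = + centralBinomial m
    D′ = + centralBinomial (suc m)
    X₀ = D ℤ.* D ℤ.* oddPoly (1ℤ ℤ.+ + 2 ℤ.* + m)
    X₁ = D′ ℤ.* D′ ℤ.* evenPoly (+ 2 ℤ.* + suc m)
    X₂ = D′ ℤ.* D′ ℤ.* oddPoly (1ℤ ℤ.+ + 2 ℤ.* + suc m)

mainTheorem5 : (n : ℕ) → lhs n ≡ rhs n
mainTheorem5 = order2-recurrence-unique (λ n → fromℤ (c₂ (+ n))) (λ n → fromℤ (c₁ (+ n))) (λ n → fromℤ (c₀ (+ n)))
  (λ n → fromℤ-nonZero (c₂ (+ n))) lhs rhs lhs-recurrence rhs-recurrence refl refl
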